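{- If a multiplier $-\ltimes U:\mathcal W\to\mathcal V$ is affine and connection-free, then it is strongly connection-free: for every $W_0\in\mathcal W$, every slice $(V,\varphi)\in\mathcal V/(W_0\ltimes U)$ such that $\pi_2\circ\varphi:V\to U$ is dimensionally split is isomorphic in $\mathcal V/(W_0\ltimes U)$ to $\mathrm{Fr}^{W_0}_U(W,\psi)$ for some $(W,\psi)\in\mathcal W/W_0$.
   Context: $\mathcal W$ has a terminal object $\top$. A multiplier for $U\in\mathcal V$ is a functor $-\ltimes U:\mathcal W\to\mathcal V$ with an isomorphism $\top\ltimes U\cong U$; $\pi_2:W\ltimes U\to U$ is $(!_W\ltimes U)$ followed by it. $\mathrm{Fr}_U:\mathcal W\to\mathcal V/U$, $W\mapsto(W\ltimes U,\pi_2)$, $f\mapsto f\ltimes U$. A morphism $\varphi:V\to U$ is dimensionally split if $\varphi\circ\chi=\pi_2$ for some $W\in\mathcal W$ and $\chi:W\ltimes U\to V$. Affine: $\mathrm{Fr}_U$ is full. Connection-free: every slice $(V,\varphi)\in\mathcal V/U$ with $\varphi$ dimensionally split is isomorphic to some $\mathrm{Fr}_U W$. $\mathrm{Fr}^{W_0}_U:\mathcal W/W_0\to\mathcal V/(W_0\ltimes U)$, $(W,\psi)\mapsto(W\ltimes U,\psi\ltimes U)$. -}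

module Defs where

open import Level using (Level; _⊔_; suc)
open import Data.Product using (Σ; Σ-syntax; _,_)
open import Relation.Binary.Structures using (IsEquivalence)

record Category (o ℓ e : Level) : Set (suc (o ⊔ ℓ ⊔ e)) where
  infix  4 _≈_
  infixr 9 _∘_
  field
    Obj   : Set o
    Hom   : Obj → Obj → Set ℓ
    _≈_   : ∀ {A B} → Hom A B → Hom A B → Set e
    id    : ∀ {A} → Hom A A
    _∘_   : ∀ {A B C} → Hom B C → Hom A B → Hom A C
    ≈-equiv   : ∀ {A B} → IsEquivalence (_≈_ {A} {B})
    ∘-resp-≈  : ∀ {A B C} {f h : Hom B C} {g i : Hom A B} →
                f ≈ h → g ≈ i → f ∘ g ≈ h ∘ i
    identityˡ : ∀ {A B} {f : Hom A B} → id ∘ f ≈ f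
    identityʳ : ∀ {A B} {f : Hom A B} → f ∘ id ≈ f
    assoc     : ∀ {A B C D} {f : Hom A B} {g : Hom B C} {h : Hom C D} →
                (h ∘ g) ∘ f ≈ h ∘ (g ∘ f)

record Functor {o ℓ e o′ ℓ′ e′} (C : Category o ℓ e) (D : Category o′ ℓ′ e′)
       : Set (o ⊔ ℓ ⊔ e ⊔ o′ ⊔ ℓ′ ⊔ e′) where
  private
    module C = Category C
    module D = Category D
  field
    F₀ : C.Obj → D.Obj
    F₁ : ∀ {A B} → C.Hom A B → D.Hom (F₀ A) (F₀ B)
    identity     : ∀ {A} → F₁ (C.id {A}) D.≈ D.id
    homomorphism : ∀ {A B C} {f : C.Hom A B} {g : C.Hom B C} →
                   F₁ (g C.∘ f) D.≈ F₁ g D.∘ F₁ f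
    F-resp-≈     : ∀ {A B} {f g : C.Hom A B} → f C.≈ g → F₁ f D.≈ F₁ g

record Terminal {o ℓ e} (C : Category o ℓ e) : Set (o ⊔ ℓ ⊔ e) where
  open Category C
  field
    ⊤        : Obj
    !        : ∀ {A} → Hom A ⊤
    !-unique : ∀ {A} (f : Hom A ⊤) → ! ≈ f

record Iso {o ℓ e} (C : Category o ℓ e) (A B : Category.Obj C) : Set (ℓ ⊔ e) where
  open Category C
  field
    to      : Hom A B
    from    : Hom B A
    isoˡ    : from ∘ to ≈ id
    isoʳ    : to ∘ from ≈ id

record SliceIso {o ℓ e} (C : Category o ℓ e) (X : Category.Obj C)
                {A B : Category.Obj C}
                (f : Category.Hom C A X) (g : Category.Hom C B X) : Set (ℓ ⊔ e) where
  open Category C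
  field
    to     : Hom A B
    from   : Hom B A
    to-comm   : g ∘ to ≈ f
    from-comm : f ∘ from ≈ g
    isoˡ   : from ∘ to ≈ id
    isoʳ   : to ∘ from ≈ id

record Multiplier {o ℓ e o′ ℓ′ e′}
       (𝒲 : Category o ℓ e) (T : Terminal 𝒲) (𝒱 : Category o′ ℓ′ e′)
       (U : Category.Obj 𝒱) : Set (o ⊔ ℓ ⊔ e ⊔ o′ ⊔ ℓ′ ⊔ e′) where
  field
    functor : Functor 𝒲 𝒱
    unit    : Iso 𝒱 (Functor.F₀ functor (Terminal.⊤ T)) U

module MultiplierNotions {o ℓ e o′ ℓ′ e′}
       {𝒲 : Category o ℓ e} {T : Terminal 𝒲} {𝒱 : Category o′ ℓ′ e′}
       {U : Category.Obj 𝒱} (M : Multiplier 𝒲 T 𝒱 U) where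
  private
    module W = Category 𝒲
    module V = Category 𝒱
    open Multiplier M
  _⋉U : W.Obj → V.Obj
  _⋉U = Functor.F₀ functor

  _⋉₁U : ∀ {A B} → W.Hom A B → V.Hom (A ⋉U) (B ⋉U)
  _⋉₁U = Functor.F₁ functor

  π₂ : (W : W.Obj) → V.Hom (W ⋉U) U
  π₂ W = Iso.to unit V.∘ (Terminal.! T {W} ⋉₁U)

  DimensionallySplit : ∀ {A} → V.Hom A U → Set (o ⊔ ℓ′ ⊔ e′)
  DimensionallySplit {A} φ =
    Σ[ W ∈ W.Obj ] Σ[ χ ∈ V.Hom (W ⋉U) A ] (φ V.∘ χ V.≈ π₂ W)

  -- Affine: Fr_U : W → V/U is full.  (A morphism Fr_U W → Fr_U W' in V/U
  -- is g : W ⋉ U → W' ⋉ U with π₂ W' ∘ g ≈ π₂ W; slice morphisms are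
  -- compared by their underlying morphisms.)
  Affine : Set (o ⊔ ℓ ⊔ ℓ′ ⊔ e′)
  Affine = ∀ (W W′ : W.Obj) (g : V.Hom (W ⋉U) (W′ ⋉U)) →
           π₂ W′ V.∘ g V.≈ π₂ W →
           Σ[ f ∈ W.Hom W W′ ] (f ⋉₁U V.≈ g)

  ConnectionFree : Set (o ⊔ o′ ⊔ ℓ′ ⊔ e′)
  ConnectionFree = ∀ (A : V.Obj) (φ : V.Hom A U) → DimensionallySplit φ →
                   Σ[ W ∈ W.Obj ] SliceIso 𝒱 U φ (π₂ W)

  -- Strongly connection-free: every (A , φ) ∈ V/(W₀ ⋉ U) with π₂ ∘ φ
  -- dimensionally split is isomorphic to Fr^{W₀}_U (W , ψ) = (W ⋉ U , ψ ⋉ U).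
  StronglyConnectionFree : Set (o ⊔ ℓ ⊔ o′ ⊔ ℓ′ ⊔ e′)
  StronglyConnectionFree =
    ∀ (W₀ : W.Obj) (A : V.Obj) (φ : V.Hom A (W₀ ⋉U)) →
    DimensionallySplit (π₂ W₀ V.∘ φ) →
    Σ[ W ∈ W.Obj ] Σ[ ψ ∈ W.Hom W W₀ ] SliceIso 𝒱 (W₀ ⋉U) φ (ψ ⋉₁U)

{-# OPTIONS --safe #-}
module Submission where

open import Defs
open import Data.Product using (_,_)
open import Relation.Binary.Structures using (IsEquivalence)

-- By connection-freeness, (A , π₂ ∘ φ) is isomorphic over U to some Fr_U W.
-- Transporting φ along that isomorphism gives a map W ⋉ U → W₀ ⋉ U over U,
-- which by affineness is ψ ⋉ U for some ψ : W → W₀; the same isomorphism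
-- then identifies (A , φ) with (W ⋉ U , ψ ⋉ U) over W₀ ⋉ U.

module _ {o ℓ e} {C : Category o ℓ e} where
  open Category C
  private
    module ≈ {A B} = IsEquivalence (≈-equiv {A} {B})

  SliceIso⇒Iso : ∀ {X A B} {f : Hom A X} {g : Hom B X} →
                 SliceIso C X f g → Iso C A B
  SliceIso⇒Iso i = record { to = to ; from = from ; isoˡ = isoˡ ; isoʳ = isoʳ }
    where open SliceIso i

  sliceIso-transport : ∀ {X A B} (i : Iso C A B) (f : Hom A X) →
                       SliceIso C X f (f ∘ Iso.from i)
  sliceIso-transport i f = record
    { to        = to
    ; from      = from
    ; to-comm   = ≈.trans assoc (≈.trans (∘-resp-≈ ≈.refl isoˡ) identityʳ)
    ; from-comm = ≈.refl
    ; isoˡ      = isoˡ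
    ; isoʳ      = isoʳ
    }
    where open Iso i

  sliceIso-resp-≈ : ∀ {X A B} {f : Hom A X} {g g′ : Hom B X} →
                    g ≈ g′ → SliceIso C X f g → SliceIso C X f g′
  sliceIso-resp-≈ g≈g′ i = record
    { to        = to
    ; from      = from
    ; to-comm   = ≈.trans (∘-resp-≈ (≈.sym g≈g′) ≈.refl) to-comm
    ; from-comm = ≈.trans from-comm g≈g′
    ; isoˡ      = isoˡ
    ; isoʳ      = isoʳ
    }
    where open SliceIso i

  from-comm-postcomp : ∀ {X Y A B} {p : Hom Y X} {f : Hom A Y} {g : Hom B X}
                       (i : SliceIso C X (p ∘ f) g) →
                       p ∘ (f ∘ SliceIso.from i) ≈ g
  from-comm-postcomp i = ≈.trans (≈.sym assoc) (SliceIso.from-comm i)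

module _ {o ℓ e o′ ℓ′ e′} {𝒲 : Category o ℓ e} {T : Terminal 𝒲}
         {𝒱 : Category o′ ℓ′ e′} {U : Category.Obj 𝒱}
         (M : Multiplier 𝒲 T 𝒱 U) where
  open Category 𝒱
  open MultiplierNotions M

  affine∧connectionFree⇒stronglyConnectionFree :
    Affine → ConnectionFree → StronglyConnectionFree
  affine∧connectionFree⇒stronglyConnectionFree affine connectionFree W₀ A φ split
    with connectionFree A (π₂ W₀ ∘ φ) split
  ... | W , i with affine W W₀ (φ ∘ SliceIso.from i) (from-comm-postcomp i)
  ... | ψ , ψ⋉U≈ =
    W , ψ , sliceIso-resp-≈ (IsEquivalence.sym ≈-equiv ψ⋉U≈)
                            (sliceIso-transport (SliceIso⇒Iso i) φ)

mainTheorem11 : ∀ {o ℓ e o′ ℓ′ e′}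
    (𝒲 : Category o ℓ e) (T : Terminal 𝒲) (𝒱 : Category o′ ℓ′ e′)
    (U : Category.Obj 𝒱) (M : Multiplier 𝒲 T 𝒱 U) →
    MultiplierNotions.Affine M →
    MultiplierNotions.ConnectionFree M →
    MultiplierNotions.StronglyConnectionFree M
mainTheorem11 𝒲 T 𝒱 U M = affine∧connectionFree⇒stronglyConnectionFree M
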